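{- Let $q$ be a prime power, $t$ a positive integer, $n=2t$, $\xi\in\mathbb{F}_{q^n}\setminus\mathbb{F}_{q^t}$, $f\in\mathcal{L}_{t,q}$, and let $\alpha\in\mathbb{F}_{q^n}^*$ with $\alpha^{ -1}=\alpha_0+\xi\alpha_1$, $\alpha_0,\alpha_1\in\mathbb{F}_{q^t}$. Suppose that the map $\psi_{\alpha_0,\alpha_1}(X)=f(\alpha_0X)-\alpha_1X$ of $\mathbb{F}_{q^t}$ is invertible. Then the point $\langle(1,\alpha)\rangle_{\mathbb{F}_{q^n}}$ has weight at most one in $L_{S_{f,\xi}\times S_{\mathrm{Tr}_{q^t/q},\xi}}$.
   Context: $\mathcal{L}_{t,q}$ is the set of $\mathbb{F}_q$-linearised polynomials $\sum_{i=0}^{t-1}c_iX^{q^i}$, $c_i\in\mathbb{F}_{q^t}$, viewed as $\mathbb{F}_q$-linear maps of $\mathbb{F}_{q^t}$. $\mathrm{Tr}_{q^t/q}(x)=\sum_{i=0}^{t-1}x^{q^i}$. For such $h$ and $\zeta\in\mathbb{F}_{q^{2t}}\setminus\mathbb{F}_{q^t}$, $S_{h,\zeta}=\{u+\zeta h(u):u\in\mathbb{F}_{q^t}\}$. For an $\mathbb{F}_q$-subspace $U$ of $\mathbb{F}_{q^n}^2$, $L_U=\{\langle u\rangle_{\mathbb{F}_{q^n}}: u\in U\setminus\{0\}\}$ and the weight of a point $\langle v\rangle_{\mathbb{F}_{q^n}}$ is $\dim_{\mathbb{F}_q}(U\cap\langle v\rangle_{\mathbb{F}_{q^n}})$. $S\times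 T=\{(s,t):s\in S,t\in T\}$. -}

module Defs where

open import Level using (0ℓ)
open import Data.Nat as ℕ using (ℕ; zero; suc; _≥_)
open import Data.Nat.Primality using (Prime)
open import Data.Fin using (Fin)
open import Data.Product using (Σ; ∃; ∃-syntax; _×_; _,_)
open import Relation.Binary.PropositionalEquality using (_≡_)
open import Relation.Nullary using (¬_)
open import Function.Bundles using (_↔_)
open import Algebra.Structures using (IsCommutativeRing)

IsPrimePower : ℕ → Set
IsPrimePower q = ∃[ p ] ∃[ k ] (Prime p × k ≥ 1 × q ≡ p ℕ.^ k)

record FiniteField (m : ℕ) : Set₁ where
  infixl 6 _+_
  infixl 7 _*_
  field
    Carrier : Set
    _+_ _*_ : Carrier → Carrier → Carrier
    -_ : Carrier → Carrier
    0# 1# : Carrier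
    isCommutativeRing : IsCommutativeRing _≡_ _+_ _*_ -_ 0# 1#
    0≢1 : ¬ (0# ≡ 1#)
    inverse : ∀ x → ¬ (x ≡ 0#) → ∃[ y ] (x * y ≡ 1#)
    card : Carrier ↔ Fin m

module FieldOps {m : ℕ} (F : FiniteField m) where
  open FiniteField F public

  _^_ : Carrier → ℕ → Carrier
  x ^ zero = 1#
  x ^ suc k = x * (x ^ k)

  sumTo : ℕ → (ℕ → Carrier) → Carrier
  sumTo zero g = 0#
  sumTo (suc k) g = sumTo k g + g k

  -- the subfield F_{q^s} = { x : x^{q^s} = x }
  InSub : (q s : ℕ) → Carrier → Set
  InSub q s x = x ^ (q ℕ.^ s) ≡ x

module Linearised {m : ℕ} (F : FiniteField m) (q t : ℕ) where
  open FieldOps F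

  -- the F_q-linearised polynomial Σ_{i<t} c_i X^{q^i}, c_i ∈ F_{q^t}
  record LinPoly : Set where
    field
      coeff : ℕ → Carrier
      coeff-in : ∀ i → InSub q t (coeff i)

  eval : LinPoly → Carrier → Carrier
  eval f x = sumTo t (λ i → LinPoly.coeff f i * (x ^ (q ℕ.^ i)))

  Tr : Carrier → Carrier
  Tr x = sumTo t (λ i → x ^ (q ℕ.^ i))

  InS : (Carrier → Carrier) → Carrier → Carrier → Set
  InS h ζ z = ∃[ u ] (InSub q t u × z ≡ u + ζ * h u)

  InU : LinPoly → Carrier → Carrier × Carrier → Set
  InU f ξ (a , b) = InS (eval f) ξ a × InS Tr ξ b

  InSpan : Carrier × Carrier → Carrier × Carrier → Set
  InSpan (v₁ , v₂) (a , b) = ∃[ λ' ] (a ≡ λ' * v₁ × b ≡ λ' * v₂)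

  -- weight of ⟨v⟩ in L_U is at most one:
  -- dim_{F_q}(U ∩ ⟨v⟩) ≤ 1, i.e. any two vectors of U ∩ ⟨v⟩ are F_q-linearly dependent
  WeightAtMostOne : (Carrier × Carrier → Set) → Carrier × Carrier → Set
  WeightAtMostOne U v =
    ∀ w₁ w₂ → U w₁ → InSpan v w₁ → U w₂ → InSpan v w₂ →
      ∃[ a ] ∃[ b ] (InSub q 1 a × InSub q 1 b × ¬ (a ≡ 0# × b ≡ 0#) ×
        (a * Data.Product.proj₁ w₁ + b * Data.Product.proj₁ w₂ ≡ 0#) ×
        (a * Data.Product.proj₂ w₁ + b * Data.Product.proj₂ w₂ ≡ 0#))

{-# OPTIONS --safe #-}
module Submission where

-- Let w₁, w₂ ∈ S_{f,ξ} × S_{Tr,ξ} lie on ⟨(1, α)⟩, with second coordinates vᵢ + ξ Tr(vᵢ).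
-- As Tr(vᵢ) ∈ F_q, some nontrivial F_q-combination a w₁ + b w₂ has trace part zero, so its
-- second coordinate is v ∈ F_{q^t}; by F_q-linearity of f its first coordinate is u + ξ f(u).
-- On the line, u + ξ f(u) = α⁻¹ v = α₀ v + ξ α₁ v, and since 1, ξ are independent over F_{q^t},
-- u = α₀ v and f(u) = α₁ v, i.e. ψ(v) = 0. Injectivity of ψ gives v = 0, so u = 0 and
-- a w₁ + b w₂ = 0. All the F_q-linearity rests on additivity of x ↦ x ^ p ^ j in characteristic p.

open import Defs
open import Level using (0ℓ)
open import Data.Nat as ℕ using (ℕ; zero; suc; _<_; _≥_; z≤n; s≤s; z<s)
import Data.Nat.Properties as ℕ
open import Data.Nat.Combinatorics using (_C_; nCk+nC[k+1]≡[n+1]C[k+1]; nCn≡1; nC1≡n; k>n⇒nCk≡0)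
open import Data.Nat.Divisibility using (_∣_; divides; ∣⇒≤)
open import Data.Nat.Primality using (Prime; euclidsLemma)
open import Data.Nat.Solver using (module +-*-Solver)
open import Data.Fin using (Fin; fromℕ)
open import Data.Fin.Patterns using (0F)
import Data.Fin.Properties as Fin
open import Data.Vec.Functional using (tail; init)
open import Data.Fin.Permutation using (Permutation; permutation)
open import Data.Product using (∃-syntax; _×_; _,_; proj₁; proj₂)
open import Data.Sum using (_⊎_; inj₁; inj₂)
open import Data.Empty using (⊥-elim)
open import Function.Bundles using (Inverse)
open import Relation.Nullary using (¬_; Dec; yes; no)
open import Relation.Nullary.Decidable using (via-injection)
open import Function.Properties.Inverse using (↔⇒↣)
open import Relation.Binary.PropositionalEquality
open import Algebra.Bundles using (CommutativeRing)
import Algebra.Solver.Ring.NaturalCoefficients.Default as SemiringSolver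
import Algebra.Properties.Ring as RingProperties
import Algebra.Properties.CommutativeSemigroup as CommutativeSemigroupProperties
import Algebra.Properties.Semiring.Mult as Mult
import Algebra.Properties.CommutativeSemiring.Exp as CommutativeExp
import Algebra.Properties.CommutativeMonoid.Sum as Sum
import Algebra.Properties.CommutativeSemiring.Binomial as Binomial

[1+k]*[1+n]C[1+k]≡[1+n]*nCk : ∀ n k → suc k ℕ.* (suc n C suc k) ≡ suc n ℕ.* (n C k)
[1+k]*[1+n]C[1+k]≡[1+n]*nCk zero zero = refl
[1+k]*[1+n]C[1+k]≡[1+n]*nCk zero (suc k) =
  trans (cong (suc (suc k) ℕ.*_) (k>n⇒nCk≡0 {1} {suc (suc k)} (s≤s (s≤s z≤n)))) (ℕ.*-zeroʳ (suc (suc k)))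
[1+k]*[1+n]C[1+k]≡[1+n]*nCk (suc n) zero =
  trans (ℕ.+-identityʳ (suc (suc n) C 1)) (trans (nC1≡n (suc (suc n))) (sym (ℕ.*-identityʳ (suc (suc n)))))
[1+k]*[1+n]C[1+k]≡[1+n]*nCk (suc n) (suc k) = begin
  suc (suc k) ℕ.* (suc (suc n) C suc (suc k))
    ≡⟨ cong (suc (suc k) ℕ.*_) (nCk+nC[k+1]≡[n+1]C[k+1] (suc n) (suc k)) ⟨
  suc (suc k) ℕ.* (A ℕ.+ B)
    ≡⟨ solve 3 (λ k a b → (con 2 :+ k) :* (a :+ b) := a :+ (con 1 :+ k) :* a :+ (con 2 :+ k) :* b) refl k A B ⟩
  A ℕ.+ suc k ℕ.* A ℕ.+ suc (suc k) ℕ.* B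
    ≡⟨ cong₂ (λ x y → A ℕ.+ x ℕ.+ y) ([1+k]*[1+n]C[1+k]≡[1+n]*nCk n k) ([1+k]*[1+n]C[1+k]≡[1+n]*nCk n (suc k)) ⟩
  A ℕ.+ suc n ℕ.* (n C k) ℕ.+ suc n ℕ.* (n C suc k)
    ≡⟨ solve 4 (λ n a c d → a :+ (con 1 :+ n) :* c :+ (con 1 :+ n) :* d := a :+ (con 1 :+ n) :* (c :+ d)) refl n A (n C k) (n C suc k) ⟩
  A ℕ.+ suc n ℕ.* (n C k ℕ.+ n C suc k)
    ≡⟨ cong (λ z → A ℕ.+ suc n ℕ.* z) (nCk+nC[k+1]≡[n+1]C[k+1] n k) ⟩
  suc (suc n) ℕ.* A ∎
  where
  open ≡-Reasoning
  open +-*-Solver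
  A = suc n C suc k
  B = suc n C suc (suc k)

prime∣pCk : ∀ {p k} → Prime p → 0 < k → k < p → p ∣ p C k
prime∣pCk {suc n} {suc k} p-prime _ (s≤s k<n)
  with euclidsLemma (suc k) (suc n C suc k) p-prime
         (divides (n C k) (trans ([1+k]*[1+n]C[1+k]≡[1+n]*nCk n k) (ℕ.*-comm (suc n) (n C k))))
... | inj₁ p∣1+k = ⊥-elim (ℕ.<⇒≱ (s≤s k<n) (∣⇒≤ p∣1+k))
... | inj₂ p∣pCk = p∣pCk

module FiniteFieldProperties {m : ℕ} (F : FiniteField m) where
  open FieldOps F public

  commutativeRing : CommutativeRing 0ℓ 0ℓ
  commutativeRing = record { isCommutativeRing = isCommutativeRing }

  open CommutativeRing commutativeRing public
    using (+-assoc; +-comm; +-identityˡ; +-identityʳ; -‿inverseˡ; -‿inverseʳ;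
           *-assoc; *-comm; *-identityˡ; *-identityʳ; zeroʳ; distribʳ)
  open CommutativeRing commutativeRing using (ring; semiring; commutativeSemiring; +-commutativeMonoid; +-commutativeSemigroup)
  open RingProperties ring public
    using (+-identityˡ-unique; +-inverseʳ-unique; x+x≈x⇒x≈0; -0#≈0#; x∙y⁻¹≈ε⇒x≈y; +-cancelˡ; +-cancelʳ;
           -‿+-comm; -‿injective; -‿distribˡ-*; x[y-z]≈xy-xz)
  open CommutativeSemigroupProperties +-commutativeSemigroup using () renaming (interchange to +-interchange)
  open Mult semiring public using () renaming (_×_ to _·_)
  open Mult semiring using (×-assoc-*; ×1-homo-*)
  open CommutativeExp commutativeSemiring using ()
    renaming (_^_ to _^′_; ^-distrib-* to ^′-distrib-*; ^-assocʳ to ^′-assocʳ)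

  _≟_ : (x y : Carrier) → Dec (x ≡ y)
  _≟_ = via-injection (↔⇒↣ card) Fin._≟_

  open SemiringSolver commutativeSemiring public using (solve; _:=_; _:+_; _:*_; con)

  open Sum +-commutativeMonoid using (sum; sum-permute; sum-cong-≗; ∑-distrib-+; sum-replicate; sum-replicate-zero; sum-init-last)
  open Binomial commutativeSemiring using (theorem; binomialTerm)

  x*y≡0⇒x≡0⊎y≡0 : ∀ x y → x * y ≡ 0# → x ≡ 0# ⊎ y ≡ 0#
  x*y≡0⇒x≡0⊎y≡0 x y xy≡0 with x ≟ 0#
  ... | yes x≡0 = inj₁ x≡0
  ... | no x≢0 with inverse x x≢0
  ...   | x⁻¹ , xx⁻¹≡1 = inj₂ (begin
    y               ≡⟨ *-identityˡ y ⟨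
    1# * y          ≡⟨ cong (_* y) xx⁻¹≡1 ⟨
    (x * x⁻¹) * y   ≡⟨ solve 3 (λ x x⁻¹ y → (x :* x⁻¹) :* y := x⁻¹ :* (x :* y)) refl x x⁻¹ y ⟩
    x⁻¹ * (x * y)   ≡⟨ cong (x⁻¹ *_) xy≡0 ⟩
    x⁻¹ * 0#        ≡⟨ zeroʳ x⁻¹ ⟩
    0#              ∎)
    where open ≡-Reasoning

  x^n≡0⇒x≡0 : ∀ x n → x ^ n ≡ 0# → x ≡ 0#
  x^n≡0⇒x≡0 x zero 1≡0 = ⊥-elim (0≢1 (sym 1≡0))
  x^n≡0⇒x≡0 x (suc n) x^[1+n]≡0 with x*y≡0⇒x≡0⊎y≡0 x (x ^ n) x^[1+n]≡0
  ... | inj₁ x≡0   = x≡0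
  ... | inj₂ x^n≡0 = x^n≡0⇒x≡0 x n x^n≡0

  1^n≡1 : ∀ n → 1# ^ n ≡ 1#
  1^n≡1 zero    = refl
  1^n≡1 (suc n) = trans (*-identityˡ _) (1^n≡1 n)

  ^′≡^ : ∀ x n → x ^′ n ≡ x ^ n
  ^′≡^ x zero    = refl
  ^′≡^ x (suc n) = cong (x *_) (^′≡^ x n)

  ^-distrib-* : ∀ x y n → (x * y) ^ n ≡ x ^ n * y ^ n
  ^-distrib-* x y n = begin
    (x * y) ^ n      ≡⟨ ^′≡^ (x * y) n ⟨
    (x * y) ^′ n     ≡⟨ ^′-distrib-* x y n ⟩
    x ^′ n * y ^′ n  ≡⟨ cong₂ _*_ (^′≡^ x n) (^′≡^ y n) ⟩
    x ^ n * y ^ n    ∎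
    where open ≡-Reasoning

  ^-*-assoc : ∀ x a b → (x ^ a) ^ b ≡ x ^ (a ℕ.* b)
  ^-*-assoc x a b = begin
    (x ^ a) ^ b      ≡⟨ cong (_^ b) (^′≡^ x a) ⟨
    (x ^′ a) ^ b     ≡⟨ ^′≡^ (x ^′ a) b ⟨
    (x ^′ a) ^′ b    ≡⟨ ^′-assocʳ x a b ⟩
    x ^′ (a ℕ.* b)   ≡⟨ ^′≡^ x (a ℕ.* b) ⟩
    x ^ (a ℕ.* b)    ∎
    where open ≡-Reasoning

  translation : Carrier → Permutation m m
  translation c = permutation (shift c) (shift (- c))
    (shift-shift c (- c) (-‿inverseʳ c)) (shift-shift (- c) c (-‿inverseˡ c))
    where
    open Inverse card using (to; from; strictlyInverseˡ; strictlyInverseʳ)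
    shift : Carrier → Fin m → Fin m
    shift c i = to (c + from i)
    shift-shift : ∀ c d → c + d ≡ 0# → ∀ i → shift c (shift d i) ≡ i
    shift-shift c d c+d≡0 i = begin
      to (c + from (to (d + from i))) ≡⟨ cong (λ z → to (c + z)) (strictlyInverseʳ (d + from i)) ⟩
      to (c + (d + from i))           ≡⟨ cong to (+-assoc c d (from i)) ⟨
      to ((c + d) + from i)           ≡⟨ cong (λ z → to (z + from i)) c+d≡0 ⟩
      to (0# + from i)                ≡⟨ cong to (+-identityˡ (from i)) ⟩
      to (from i)                     ≡⟨ strictlyInverseˡ i ⟩
      i                               ∎
      where open ≡-Reasoning

  -- Translation by 1# permutes the field, so the sum Σ of all its elements satisfies Σ ≡ m · 1# + Σ.
  card·1≡0 : m · 1# ≡ 0#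
  card·1≡0 = +-identityˡ-unique (m · 1#) Σ (sym (begin
    Σ                                   ≡⟨ sum-permute from (translation 1#) ⟩
    sum (λ i → from (to (1# + from i))) ≡⟨ sum-cong-≗ (λ i → strictlyInverseʳ (1# + from i)) ⟩
    sum (λ i → 1# + from i)             ≡⟨ ∑-distrib-+ (λ _ → 1#) from ⟩
    sum {m} (λ _ → 1#) + Σ              ≡⟨ cong (_+ Σ) (sum-replicate m) ⟩
    m · 1# + Σ                          ∎))
    where
    open ≡-Reasoning
    open Inverse card using (to; from; strictlyInverseʳ)
    Σ = sum from

  ·1-homo-^ : ∀ p K → (p ℕ.^ K) · 1# ≡ (p · 1#) ^ K
  ·1-homo-^ p zero    = +-identityʳ 1#
  ·1-homo-^ p (suc K) = trans (×1-homo-* p (p ℕ.^ K)) (cong ((p · 1#) *_) (·1-homo-^ p K))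

  card≡p^K⇒p·1≡0 : ∀ {p K} → m ≡ p ℕ.^ K → p · 1# ≡ 0#
  card≡p^K⇒p·1≡0 {p} {K} m≡p^K = x^n≡0⇒x≡0 (p · 1#) K (begin
    (p · 1#) ^ K    ≡⟨ ·1-homo-^ p K ⟨
    (p ℕ.^ K) · 1#  ≡⟨ cong (_· 1#) m≡p^K ⟨
    m · 1#          ≡⟨ card·1≡0 ⟩
    0#              ∎)
    where open ≡-Reasoning

  p∣c⇒c·x≡0 : ∀ {p c} → p · 1# ≡ 0# → p ∣ c → ∀ x → c · x ≡ 0#
  p∣c⇒c·x≡0 {p} p·1≡0 (divides d refl) x = begin
    (d ℕ.* p) · x               ≡⟨ cong ((d ℕ.* p) ·_) (*-identityˡ x) ⟨
    (d ℕ.* p) · (1# * x)        ≡⟨ ×-assoc-* (d ℕ.* p) 1# x ⟨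
    ((d ℕ.* p) · 1#) * x        ≡⟨ cong (_* x) (×1-homo-* d p) ⟩
    ((d · 1#) * (p · 1#)) * x   ≡⟨ cong (λ z → ((d · 1#) * z) * x) p·1≡0 ⟩
    ((d · 1#) * 0#) * x         ≡⟨ solve 2 (λ c x → (c :* con 0) :* x := con 0) refl (d · 1#) x ⟩
    0#                          ∎
    where open ≡-Reasoning

  PowerAdditive : ℕ → Set
  PowerAdditive N = ∀ x y → (x + y) ^ N ≡ x ^ N + y ^ N

  power-additive-1 : PowerAdditive 1
  power-additive-1 = distribʳ 1#

  power-additive-* : ∀ {a b} → PowerAdditive a → PowerAdditive b → PowerAdditive (a ℕ.* b)
  power-additive-* {a} {b} add-a add-b x y = begin
    (x + y) ^ (a ℕ.* b)              ≡⟨ ^-*-assoc (x + y) a b ⟨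
    ((x + y) ^ a) ^ b                ≡⟨ cong (_^ b) (add-a x y) ⟩
    (x ^ a + y ^ a) ^ b              ≡⟨ add-b (x ^ a) (y ^ a) ⟩
    (x ^ a) ^ b + (y ^ a) ^ b        ≡⟨ cong₂ _+_ (^-*-assoc x a b) (^-*-assoc y a b) ⟩
    x ^ (a ℕ.* b) + y ^ (a ℕ.* b)    ∎
    where open ≡-Reasoning

  freshman's-dream : ∀ {p} → Prime p → p · 1# ≡ 0# → PowerAdditive p
  freshman's-dream {suc n} p-prime p·1≡0 x y = begin
    (x + y) ^ p                                 ≡⟨ ^′≡^ (x + y) p ⟨
    (x + y) ^′ p                                ≡⟨ theorem p x y ⟩
    T 0F + sum (tail T)                         ≡⟨ cong (T 0F +_) (sum-init-last (tail T)) ⟩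
    T 0F + (sum (init (tail T)) + T (fromℕ p))  ≡⟨ cong (λ s → T 0F + (s + T (fromℕ p))) inner-terms-vanish ⟩
    T 0F + (0# + T (fromℕ p))                   ≡⟨ cong₂ (λ a b → a + (0# + b)) first-term (last-term (Fin.toℕ-fromℕ p)) ⟩
    y ^ p + (0# + x ^ p)                        ≡⟨ solve 2 (λ x y → y :+ (con 0 :+ x) := x :+ y) refl (x ^ p) (y ^ p) ⟩
    x ^ p + y ^ p                               ∎
    where
    open ≡-Reasoning
    p = suc n
    T = binomialTerm x y p
    inner-terms-vanish : sum (init (tail T)) ≡ 0#
    inner-terms-vanish = trans
      (sum-cong-≗ (λ i → p∣c⇒c·x≡0 p·1≡0 (prime∣pCk p-prime z<s (s≤s (Fin.inject₁ℕ< i))) _))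
      (sum-replicate-zero n)
    first-term : T 0F ≡ y ^ p
    first-term = trans (+-identityʳ _) (trans (*-identityˡ _) (^′≡^ y p))
    last-term : ∀ {j} → j ≡ p → (p C j) · (x ^′ j * y ^′ (p ℕ.∸ j)) ≡ x ^ p
    last-term refl rewrite nCn≡1 p | ℕ.n∸n≡0 n =
      trans (+-identityʳ _) (trans (*-identityʳ _) (^′≡^ x p))

  frobenius-additive : ∀ {p} → Prime p → p · 1# ≡ 0# → ∀ j → PowerAdditive (p ℕ.^ j)
  frobenius-additive p-prime p·1≡0 zero    = power-additive-1
  frobenius-additive {p} p-prime p·1≡0 (suc j) =
    power-additive-* {p} {p ℕ.^ j} (freshman's-dream p-prime p·1≡0) (frobenius-additive p-prime p·1≡0 j)

  sumTo-cong : ∀ k {g h} → (∀ i → g i ≡ h i) → sumTo k g ≡ sumTo k h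
  sumTo-cong zero    g≗h = refl
  sumTo-cong (suc k) g≗h = cong₂ _+_ (sumTo-cong k g≗h) (g≗h k)

  sumTo-suc : ∀ k g → sumTo (suc k) g ≡ g 0 + sumTo k (λ i → g (suc i))
  sumTo-suc zero    g = trans (+-identityˡ (g 0)) (sym (+-identityʳ (g 0)))
  sumTo-suc (suc k) g = trans (cong (_+ g (suc k)) (sumTo-suc k g)) (+-assoc (g 0) _ _)

  sumTo-rotate : ∀ k g → g k ≡ g 0 → sumTo k (λ i → g (suc i)) ≡ sumTo k g
  sumTo-rotate k g gk≡g0 = +-cancelˡ (g 0) _ _ (begin
    g 0 + sumTo k (λ i → g (suc i))  ≡⟨ sumTo-suc k g ⟨
    sumTo k g + g k                  ≡⟨ cong (sumTo k g +_) gk≡g0 ⟩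
    sumTo k g + g 0                  ≡⟨ +-comm (sumTo k g) (g 0) ⟩
    g 0 + sumTo k g                  ∎)
    where open ≡-Reasoning

  sumTo-lincomb : ∀ k a b g h → sumTo k (λ i → a * g i + b * h i) ≡ a * sumTo k g + b * sumTo k h
  sumTo-lincomb zero    a b g h = solve 2 (λ a b → con 0 := a :* con 0 :+ b :* con 0) refl a b
  sumTo-lincomb (suc k) a b g h = begin
    sumTo k (λ i → a * g i + b * h i) + (a * g k + b * h k)  ≡⟨ cong (_+ (a * g k + b * h k)) (sumTo-lincomb k a b g h) ⟩
    (a * sumTo k g + b * sumTo k h) + (a * g k + b * h k)    ≡⟨ solve 6 (λ a b G H g h → (a :* G :+ b :* H) :+ (a :* g :+ b :* h) := a :* (G :+ g) :+ b :* (H :+ h))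
                                                                  refl a b (sumTo k g) (sumTo k h) (g k) (h k) ⟩
    a * sumTo (suc k) g + b * sumTo (suc k) h                ∎
    where open ≡-Reasoning

  power-additive⇒0^N≡0 : ∀ {N} → PowerAdditive N → 0# ^ N ≡ 0#
  power-additive⇒0^N≡0 {N} additive =
    x+x≈x⇒x≈0 (0# ^ N) (trans (sym (additive 0# 0#)) (cong (_^ N) (+-identityʳ 0#)))

  ^-distrib-sumTo : ∀ {N} → PowerAdditive N → ∀ k g → sumTo k g ^ N ≡ sumTo k (λ i → g i ^ N)
  ^-distrib-sumTo {N} additive zero    g = power-additive⇒0^N≡0 {N} additive
  ^-distrib-sumTo {N} additive (suc k) g =
    trans (additive (sumTo k g) (g k)) (cong (_+ g k ^ N) (^-distrib-sumTo {N} additive k g))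

  x+y≡z+w⇒[x-z]+[y-w]≡0 : ∀ {x y z w} → x + y ≡ z + w → (x + - z) + (y + - w) ≡ 0#
  x+y≡z+w⇒[x-z]+[y-w]≡0 {x} {y} {z} {w} x+y≡z+w = begin
    (x + - z) + (y + - w)  ≡⟨ +-interchange x (- z) y (- w) ⟩
    (x + y) + (- z + - w)  ≡⟨ cong ((x + y) +_) (-‿+-comm z w) ⟩
    (x + y) + - (z + w)    ≡⟨ cong (λ s → s + - (z + w)) x+y≡z+w ⟩
    (z + w) + - (z + w)    ≡⟨ -‿inverseʳ (z + w) ⟩
    0#                     ∎
    where open ≡-Reasoning

  module FixedField (N : ℕ) (additive : PowerAdditive N) where

    Fixed : Carrier → Set
    Fixed x = x ^ N ≡ x

    fixed-0# : Fixed 0#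
    fixed-0# = power-additive⇒0^N≡0 {N} additive

    fixed-1# : Fixed 1#
    fixed-1# = 1^n≡1 N

    fixed-+ : ∀ {x y} → Fixed x → Fixed y → Fixed (x + y)
    fixed-+ {x} {y} x∈ y∈ = trans (additive x y) (cong₂ _+_ x∈ y∈)

    fixed-* : ∀ {x y} → Fixed x → Fixed y → Fixed (x * y)
    fixed-* {x} {y} x∈ y∈ = trans (^-distrib-* x y N) (cong₂ _*_ x∈ y∈)

    fixed-- : ∀ {x} → Fixed x → Fixed (- x)
    fixed-- {x} x∈ = trans (+-inverseʳ-unique (x ^ N) ((- x) ^ N) x^N+[-x]^N≡0) (cong -_ x∈)
      where
      x^N+[-x]^N≡0 : x ^ N + (- x) ^ N ≡ 0#
      x^N+[-x]^N≡0 = trans (sym (additive x (- x))) (trans (cong (_^ N) (-‿inverseʳ x)) fixed-0#)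

    fixed-inverse : ∀ {x y} → x * y ≡ 1# → Fixed x → Fixed y
    fixed-inverse {x} {y} xy≡1 x∈ = begin
      y ^ N                ≡⟨ *-identityʳ (y ^ N) ⟨
      y ^ N * 1#           ≡⟨ cong (y ^ N *_) xy≡1 ⟨
      y ^ N * (x * y)      ≡⟨ cong (λ z → y ^ N * (z * y)) x∈ ⟨
      y ^ N * (x ^ N * y)  ≡⟨ solve 3 (λ a b y → a :* (b :* y) := (a :* b) :* y) refl (y ^ N) (x ^ N) y ⟩
      (y ^ N * x ^ N) * y  ≡⟨ cong (_* y) (^-distrib-* y x N) ⟨
      (y * x) ^ N * y      ≡⟨ cong (λ z → z ^ N * y) (trans (*-comm y x) xy≡1) ⟩
      1# ^ N * y           ≡⟨ cong (_* y) (1^n≡1 N) ⟩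
      1# * y               ≡⟨ *-identityˡ y ⟩
      y                    ∎
      where open ≡-Reasoning

    fixed-sumTo : ∀ k {g} → (∀ i → Fixed (g i)) → Fixed (sumTo k g)
    fixed-sumTo zero    g∈ = fixed-0#
    fixed-sumTo (suc k) g∈ = fixed-+ (fixed-sumTo k g∈) (g∈ k)

    fixed-^ : ∀ {x} a → Fixed x → Fixed (x ^ a)
    fixed-^ {x} a x∈ = begin
      (x ^ a) ^ N     ≡⟨ ^-*-assoc x a N ⟩
      x ^ (a ℕ.* N)   ≡⟨ cong (x ^_) (ℕ.*-comm a N) ⟩
      x ^ (N ℕ.* a)   ≡⟨ ^-*-assoc x N a ⟨
      (x ^ N) ^ a     ≡⟨ cong (_^ a) x∈ ⟩
      x ^ a           ∎
      where open ≡-Reasoning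

    -- Otherwise ξ = - x * y⁻¹ would be fixed.
    x+ξy≡0⇒y≡0 : ∀ {ξ x y} → ¬ Fixed ξ → Fixed x → Fixed y → x + ξ * y ≡ 0# → y ≡ 0#
    x+ξy≡0⇒y≡0 {ξ} {x} {y} ξ∉ x∈ y∈ x+ξy≡0 with y ≟ 0#
    ... | yes y≡0 = y≡0
    ... | no y≢0 with inverse y y≢0
    ...   | y⁻¹ , yy⁻¹≡1 = ⊥-elim (ξ∉ (subst Fixed (sym ξ≡-xy⁻¹) (fixed-* (fixed-- x∈) (fixed-inverse yy⁻¹≡1 y∈))))
      where
      open ≡-Reasoning
      ξ≡-xy⁻¹ : ξ ≡ - x * y⁻¹
      ξ≡-xy⁻¹ = begin
        ξ               ≡⟨ *-identityʳ ξ ⟨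
        ξ * 1#          ≡⟨ cong (ξ *_) yy⁻¹≡1 ⟨
        ξ * (y * y⁻¹)   ≡⟨ *-assoc ξ y y⁻¹ ⟨
        (ξ * y) * y⁻¹   ≡⟨ cong (_* y⁻¹) (+-inverseʳ-unique x (ξ * y) x+ξy≡0) ⟩
        - x * y⁻¹       ∎

    coordinates-unique : ∀ {ξ x y x′ y′} → ¬ Fixed ξ → Fixed x → Fixed y → Fixed x′ → Fixed y′ →
                         x + ξ * y ≡ x′ + ξ * y′ → x ≡ x′ × y ≡ y′
    coordinates-unique {ξ} {x} {y} {x′} {y′} ξ∉ x∈ y∈ x′∈ y′∈ eq = x≡x′ , y≡y′
      where
      open ≡-Reasoning
      y≡y′ : y ≡ y′
      y≡y′ = x∙y⁻¹≈ε⇒x≈y y y′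
        (x+ξy≡0⇒y≡0 ξ∉ (fixed-+ x∈ (fixed-- x′∈)) (fixed-+ y∈ (fixed-- y′∈)) (begin
          (x + - x′) + ξ * (y + - y′)        ≡⟨ cong ((x + - x′) +_) (x[y-z]≈xy-xz ξ y y′) ⟩
          (x + - x′) + (ξ * y + - (ξ * y′))  ≡⟨ x+y≡z+w⇒[x-z]+[y-w]≡0 eq ⟩
          0#                                 ∎))
      x≡x′ : x ≡ x′
      x≡x′ = +-cancelʳ (ξ * y) x x′ (trans eq (cong (λ z → x′ + ξ * z) (sym y≡y′)))

    nontrivial-relation : ∀ {s₁ s₂} → Fixed s₁ → Fixed s₂ →
      ∃[ a ] ∃[ b ] (Fixed a × Fixed b × ¬ (a ≡ 0# × b ≡ 0#) × a * s₁ + b * s₂ ≡ 0#)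
    nontrivial-relation {s₁} {s₂} s₁∈ s₂∈ with s₁ ≟ 0#
    ... | yes s₁≡0 = 1# , 0# , fixed-1# , fixed-0# , (λ (1≡0 , _) → 0≢1 (sym 1≡0)) , (begin
      1# * s₁ + 0# * s₂  ≡⟨ cong (λ s → 1# * s + 0# * s₂) s₁≡0 ⟩
      1# * 0# + 0# * s₂  ≡⟨ solve 1 (λ s → con 1 :* con 0 :+ con 0 :* s := con 0) refl s₂ ⟩
      0#                 ∎)
      where open ≡-Reasoning
    ... | no s₁≢0 = s₂ , - s₁ , s₂∈ , fixed-- s₁∈ , (λ (_ , -s₁≡0) → s₁≢0 (-‿injective (trans -s₁≡0 (sym -0#≈0#)))) , (begin
      s₂ * s₁ + - s₁ * s₂     ≡⟨ cong (s₂ * s₁ +_) (-‿distribˡ-* s₁ s₂) ⟨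
      s₂ * s₁ + - (s₁ * s₂)   ≡⟨ cong (_+ - (s₁ * s₂)) (*-comm s₂ s₁) ⟩
      s₁ * s₂ + - (s₁ * s₂)   ≡⟨ -‿inverseʳ (s₁ * s₂) ⟩
      0#                      ∎)
      where open ≡-Reasoning

module LinearisedProperties {m : ℕ} (F : FiniteField m) (q t : ℕ)
  (additive : ∀ s → FiniteFieldProperties.PowerAdditive F (q ℕ.^ s)) where
  open FiniteFieldProperties F
  open Linearised F q t

  module Fq = FixedField (q ℕ.^ 1) (additive 1)
  module Fqᵗ = FixedField (q ℕ.^ t) (additive t)

  Fq⊆Fqˢ : ∀ {a} → InSub q 1 a → ∀ s → InSub q s a
  Fq⊆Fqˢ {a} a∈ zero    = *-identityʳ a
  Fq⊆Fqˢ {a} a∈ (suc s) = begin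
    a ^ (q ℕ.* q ℕ.^ s)          ≡⟨ ^-*-assoc a q (q ℕ.^ s) ⟨
    (a ^ q) ^ (q ℕ.^ s)          ≡⟨ cong (λ e → (a ^ e) ^ (q ℕ.^ s)) (ℕ.*-identityʳ q) ⟨
    (a ^ (q ℕ.^ 1)) ^ (q ℕ.^ s)  ≡⟨ cong (_^ (q ℕ.^ s)) a∈ ⟩
    a ^ (q ℕ.^ s)                ≡⟨ Fq⊆Fqˢ a∈ s ⟩
    a                            ∎
    where open ≡-Reasoning

  Fq-combination-Fqᵗ : ∀ {a b x y} → InSub q 1 a → InSub q 1 b → InSub q t x → InSub q t y →
                       InSub q t (a * x + b * y)
  Fq-combination-Fqᵗ a∈ b∈ x∈ y∈ = Fqᵗ.fixed-+ (Fqᵗ.fixed-* (Fq⊆Fqˢ a∈ t) x∈) (Fqᵗ.fixed-* (Fq⊆Fqˢ b∈ t) y∈)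

  IsFqLinear : (Carrier → Carrier) → Set
  IsFqLinear h = ∀ {a b} x y → InSub q 1 a → InSub q 1 b → h (a * x + b * y) ≡ a * h x + b * h y

  ^qⁱ-Fq-linear : ∀ i → IsFqLinear (_^ (q ℕ.^ i))
  ^qⁱ-Fq-linear i {a} {b} x y a∈ b∈ = begin
    (a * x + b * y) ^ Q            ≡⟨ additive i (a * x) (b * y) ⟩
    (a * x) ^ Q + (b * y) ^ Q      ≡⟨ cong₂ _+_ (^-distrib-* a x Q) (^-distrib-* b y Q) ⟩
    a ^ Q * x ^ Q + b ^ Q * y ^ Q  ≡⟨ cong₂ (λ a′ b′ → a′ * x ^ Q + b′ * y ^ Q) (Fq⊆Fqˢ a∈ i) (Fq⊆Fqˢ b∈ i) ⟩
    a * x ^ Q + b * y ^ Q          ∎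
    where
    open ≡-Reasoning
    Q = q ℕ.^ i

  eval-Fq-linear : ∀ f → IsFqLinear (eval f)
  eval-Fq-linear f {a} {b} x y a∈ b∈ =
    trans (sumTo-cong t term) (sumTo-lincomb t a b (λ i → c i * x ^ (q ℕ.^ i)) (λ i → c i * y ^ (q ℕ.^ i)))
    where
    c = LinPoly.coeff f
    term : ∀ i → c i * (a * x + b * y) ^ (q ℕ.^ i) ≡ a * (c i * x ^ (q ℕ.^ i)) + b * (c i * y ^ (q ℕ.^ i))
    term i = trans (cong (c i *_) (^qⁱ-Fq-linear i x y a∈ b∈))
      (solve 5 (λ c a b X Y → c :* (a :* X :+ b :* Y) := a :* (c :* X) :+ b :* (c :* Y)) refl
        (c i) a b (x ^ (q ℕ.^ i)) (y ^ (q ℕ.^ i)))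

  Tr-Fq-linear : IsFqLinear Tr
  Tr-Fq-linear {a} {b} x y a∈ b∈ =
    trans (sumTo-cong t (λ i → ^qⁱ-Fq-linear i x y a∈ b∈)) (sumTo-lincomb t a b _ _)

  Fq-linear⇒0↦0 : ∀ {h} → IsFqLinear h → h 0# ≡ 0#
  Fq-linear⇒0↦0 {h} h-linear = begin
    h 0#                   ≡⟨ cong h (solve 0 (con 0 := con 0 :* con 0 :+ con 0 :* con 0) refl) ⟩
    h (0# * 0# + 0# * 0#)  ≡⟨ h-linear 0# 0# Fq.fixed-0# Fq.fixed-0# ⟩
    0# * h 0# + 0# * h 0#  ≡⟨ solve 1 (λ z → con 0 :* z :+ con 0 :* z := con 0) refl (h 0#) ⟩
    0#                     ∎
    where open ≡-Reasoning

  eval-Fqᵗ : ∀ f {u} → InSub q t u → InSub q t (eval f u)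
  eval-Fqᵗ f u∈ = Fqᵗ.fixed-sumTo t (λ i → Fqᵗ.fixed-* (LinPoly.coeff-in f i) (Fqᵗ.fixed-^ (q ℕ.^ i) u∈))

  -- Raising to the q-th power permutes the conjugates v ^ q ^ i cyclically, as v ^ q ^ t ≡ v.
  Tr-Fq : ∀ {v} → InSub q t v → InSub q 1 (Tr v)
  Tr-Fq {v} v∈ = begin
    Tr v ^ (q ℕ.^ 1)                     ≡⟨ ^-distrib-sumTo {q ℕ.^ 1} (additive 1) t conjugate ⟩
    sumTo t (λ i → conjugate i ^ (q ℕ.^ 1)) ≡⟨ sumTo-cong t next-conjugate ⟩
    sumTo t (λ i → conjugate (suc i))    ≡⟨ sumTo-rotate t conjugate (trans v∈ (sym (*-identityʳ v))) ⟩
    Tr v                                 ∎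
    where
    open ≡-Reasoning
    conjugate : ℕ → Carrier
    conjugate i = v ^ (q ℕ.^ i)
    next-conjugate : ∀ i → conjugate i ^ (q ℕ.^ 1) ≡ conjugate (suc i)
    next-conjugate i = trans (^-*-assoc v (q ℕ.^ i) (q ℕ.^ 1))
      (cong (v ^_) (trans (ℕ.*-comm (q ℕ.^ i) (q ℕ.^ 1)) (sym (ℕ.^-distribˡ-+-* q 1 i))))

  Fq-combination-in-S : ∀ {h} → IsFqLinear h → ∀ ξ {a b} u₁ u₂ → InSub q 1 a → InSub q 1 b →
    a * (u₁ + ξ * h u₁) + b * (u₂ + ξ * h u₂) ≡ (a * u₁ + b * u₂) + ξ * h (a * u₁ + b * u₂)
  Fq-combination-in-S {h} h-linear ξ {a} {b} u₁ u₂ a∈ b∈ = begin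
    a * (u₁ + ξ * h u₁) + b * (u₂ + ξ * h u₂)    ≡⟨ solve 7 (λ a b u₁ u₂ ξ h₁ h₂ →
                                                       a :* (u₁ :+ ξ :* h₁) :+ b :* (u₂ :+ ξ :* h₂) := (a :* u₁ :+ b :* u₂) :+ ξ :* (a :* h₁ :+ b :* h₂))
                                                     refl a b u₁ u₂ ξ (h u₁) (h u₂) ⟩
    (a * u₁ + b * u₂) + ξ * (a * h u₁ + b * h u₂) ≡⟨ cong (λ z → (a * u₁ + b * u₂) + ξ * z) (h-linear u₁ u₂ a∈ b∈) ⟨
    (a * u₁ + b * u₂) + ξ * h (a * u₁ + b * u₂)  ∎
    where open ≡-Reasoning

  module _ {ξ : Carrier} (ξ∉ : ¬ InSub q t ξ) (f : LinPoly) {α α₀ α₁ : Carrier}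
           (α₀∈ : InSub q t α₀) (α₁∈ : InSub q t α₁) (αβ≡1 : α * (α₀ + ξ * α₁) ≡ 1#)
           (ψ-injective : ∀ x y → InSub q t x → InSub q t y →
              eval f (α₀ * x) + - (α₁ * x) ≡ eval f (α₀ * y) + - (α₁ * y) → x ≡ y) where

    β : Carrier
    β = α₀ + ξ * α₁

    ψ : Carrier → Carrier
    ψ x = eval f (α₀ * x) + - (α₁ * x)

    ∈⟨1,α⟩⇒x≡βy : ∀ {x y} → InSpan (1# , α) (x , y) → x ≡ β * y
    ∈⟨1,α⟩⇒x≡βy {x} {y} (λ′ , x≡λ′ , y≡λ′α) = begin
      x             ≡⟨ x≡λ′ ⟩
      λ′ * 1#       ≡⟨ cong (λ′ *_) αβ≡1 ⟨
      λ′ * (α * β)  ≡⟨ solve 3 (λ l a b → l :* (a :* b) := b :* (l :* a)) refl λ′ α β ⟩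
      β * (λ′ * α)  ≡⟨ cong (β *_) y≡λ′α ⟨
      β * y         ∎
      where open ≡-Reasoning

    ψ0≡0 : ψ 0# ≡ 0#
    ψ0≡0 = begin
      eval f (α₀ * 0#) + - (α₁ * 0#)  ≡⟨ cong₂ (λ a b → eval f a + - b) (zeroʳ α₀) (zeroʳ α₁) ⟩
      eval f 0# + - 0#                ≡⟨ cong₂ _+_ (Fq-linear⇒0↦0 (eval-Fq-linear f)) -0#≈0# ⟩
      0# + 0#                         ≡⟨ +-identityʳ 0# ⟩
      0#                              ∎
      where open ≡-Reasoning

    u+ξfu≡βv⇒u≡0×v≡0 : ∀ {u v} → InSub q t u → InSub q t v → u + ξ * eval f u ≡ β * v → u ≡ 0# × v ≡ 0#
    u+ξfu≡βv⇒u≡0×v≡0 {u} {v} u∈ v∈ u+ξfu≡βv = u≡0 , v≡0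
      where
      open ≡-Reasoning
      coordinates : u ≡ α₀ * v × eval f u ≡ α₁ * v
      coordinates = Fqᵗ.coordinates-unique ξ∉ u∈ (eval-Fqᵗ f u∈) (Fqᵗ.fixed-* α₀∈ v∈) (Fqᵗ.fixed-* α₁∈ v∈)
        (trans u+ξfu≡βv (solve 4 (λ a₀ a₁ ξ v → (a₀ :+ ξ :* a₁) :* v := a₀ :* v :+ ξ :* (a₁ :* v)) refl α₀ α₁ ξ v))
      ψv≡0 : ψ v ≡ 0#
      ψv≡0 = begin
        eval f (α₀ * v) + - (α₁ * v)  ≡⟨ cong₂ (λ a b → eval f a + - b) (proj₁ coordinates) (proj₂ coordinates) ⟨
        eval f u + - eval f u         ≡⟨ -‿inverseʳ (eval f u) ⟩
        0#                            ∎
      v≡0 : v ≡ 0#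
      v≡0 = ψ-injective v 0# v∈ Fqᵗ.fixed-0# (trans ψv≡0 (sym ψ0≡0))
      u≡0 : u ≡ 0#
      u≡0 = trans (proj₁ coordinates) (trans (cong (α₀ *_) v≡0) (zeroʳ α₀))

    weight-at-most-one : WeightAtMostOne (InU f ξ) (1# , α)
    weight-at-most-one (_ , _) (_ , _) ((u₁ , u₁∈ , refl) , (v₁ , v₁∈ , refl)) w₁∈ℓ
                                       ((u₂ , u₂∈ , refl) , (v₂ , v₂∈ , refl)) w₂∈ℓ
      with Fq.nontrivial-relation (Tr-Fq v₁∈) (Tr-Fq v₂∈)
    ... | a , b , a∈ , b∈ , ab≢0 , trace-relation = a , b , a∈ , b∈ , ab≢0 , x≡0 , y≡0
      where
      open ≡-Reasoning
      x₁ = u₁ + ξ * eval f u₁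
      x₂ = u₂ + ξ * eval f u₂
      y₁ = v₁ + ξ * Tr v₁
      y₂ = v₂ + ξ * Tr v₂
      u = a * u₁ + b * u₂
      v = a * v₁ + b * v₂
      x≡u+ξfu : a * x₁ + b * x₂ ≡ u + ξ * eval f u
      x≡u+ξfu = Fq-combination-in-S (eval-Fq-linear f) ξ u₁ u₂ a∈ b∈
      y≡v : a * y₁ + b * y₂ ≡ v
      y≡v = begin
        a * y₁ + b * y₂  ≡⟨ Fq-combination-in-S Tr-Fq-linear ξ v₁ v₂ a∈ b∈ ⟩
        v + ξ * Tr v     ≡⟨ cong (λ z → v + ξ * z) (trans (Tr-Fq-linear v₁ v₂ a∈ b∈) trace-relation) ⟩
        v + ξ * 0#       ≡⟨ solve 2 (λ v ξ → v :+ ξ :* con 0 := v) refl v ξ ⟩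
        v                ∎
      on-line : u + ξ * eval f u ≡ β * v
      on-line = begin
        u + ξ * eval f u             ≡⟨ x≡u+ξfu ⟨
        a * x₁ + b * x₂              ≡⟨ cong₂ (λ z₁ z₂ → a * z₁ + b * z₂) (∈⟨1,α⟩⇒x≡βy w₁∈ℓ) (∈⟨1,α⟩⇒x≡βy w₂∈ℓ) ⟩
        a * (β * y₁) + b * (β * y₂)  ≡⟨ solve 5 (λ a b β y₁ y₂ → a :* (β :* y₁) :+ b :* (β :* y₂) := β :* (a :* y₁ :+ b :* y₂)) refl a b β y₁ y₂ ⟩
        β * (a * y₁ + b * y₂)        ≡⟨ cong (β *_) y≡v ⟩
        β * v                        ∎
      u≡0×v≡0 = u+ξfu≡βv⇒u≡0×v≡0 (Fq-combination-Fqᵗ a∈ b∈ u₁∈ u₂∈) (Fq-combination-Fqᵗ a∈ b∈ v₁∈ v₂∈) on-line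
      x≡0 : a * x₁ + b * x₂ ≡ 0#
      x≡0 = begin
        a * x₁ + b * x₂     ≡⟨ x≡u+ξfu ⟩
        u + ξ * eval f u    ≡⟨ cong (λ z → z + ξ * eval f z) (proj₁ u≡0×v≡0) ⟩
        0# + ξ * eval f 0#  ≡⟨ cong (λ z → 0# + ξ * z) (Fq-linear⇒0↦0 (eval-Fq-linear f)) ⟩
        0# + ξ * 0#         ≡⟨ solve 1 (λ ξ → con 0 :+ ξ :* con 0 := con 0) refl ξ ⟩
        0#                  ∎
      y≡0 : a * y₁ + b * y₂ ≡ 0#
      y≡0 = trans y≡v (proj₂ u≡0×v≡0)

lemma4p2 : (q t : ℕ) → IsPrimePower q → t ≥ 1 →
    (F : FiniteField (q ℕ.^ (2 ℕ.* t))) →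
    let open FieldOps F in let open Linearised F q t in
    (ξ : Carrier) → ¬ InSub q t ξ →
    (f : LinPoly) →
    (α α₀ α₁ : Carrier) → InSub q t α₀ → InSub q t α₁ →
    α * (α₀ + ξ * α₁) ≡ 1# →
    (∀ x y → InSub q t x → InSub q t y →
      eval f (α₀ * x) + - (α₁ * x) ≡ eval f (α₀ * y) + - (α₁ * y) → x ≡ y) →
    (∀ z → InSub q t z → ∃[ x ] (InSub q t x × eval f (α₀ * x) + - (α₁ * x) ≡ z)) →
    WeightAtMostOne (InU f ξ) (1# , α)
lemma4p2 q t (p , k , p-prime , _ , refl) _ F ξ ξ∉ f α α₀ α₁ α₀∈ α₁∈ αβ≡1 ψ-injective _ =
  weight-at-most-one ξ∉ f α₀∈ α₁∈ αβ≡1 ψ-injective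
  where
  open FiniteFieldProperties F
  p·1≡0 : p · 1# ≡ 0#
  p·1≡0 = card≡p^K⇒p·1≡0 {p} {k ℕ.* (2 ℕ.* t)} (ℕ.^-*-assoc p k (2 ℕ.* t))
  additive : ∀ s → PowerAdditive ((p ℕ.^ k) ℕ.^ s)
  additive s = subst PowerAdditive (sym (ℕ.^-*-assoc p k s)) (frobenius-additive p-prime p·1≡0 (k ℕ.* s))
  open LinearisedProperties F (p ℕ.^ k) t additive
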